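{- Let $D$ be an orientation of the complete tripartite graph $K_{2,1,1}$ whose niche graph is disconnected, and suppose no two distinct vertices of $D$ are true twins in $D$. Then the niche graph of $D$ is isomorphic to $P_3 \cup K_1$.
   Context: The niche graph $\mathcal{N}(D)$ of a digraph $D$ has vertex set $V(D)$, and two distinct vertices are adjacent iff they have a common out-neighbor in $D$ or a common in-neighbor in $D$. Two vertices $u,v$ of $D$ are true twins in $D$ if $N^+_D(u)=N^+_D(v)$ and $N^-_D(u)=N^-_D(v)$. $P_3\cup K_1$ is the disjoint union of a path on $3$ vertices and an isolated vertex. -}

module Defs where

open import Data.Fin using (Fin; zero; suc)
open import Data.Product using (Σ; ∃; _×_; _,_)
open import Data.Sum using (_⊎_)
open import Data.Empty using (⊥)
open import Data.Unit using (⊤)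
open import Relation.Nullary using (¬_)
open import Relation.Binary.PropositionalEquality using (_≡_; _≢_)
open import Relation.Binary.Construct.Closure.ReflexiveTransitive using (Star)
open import Function.Bundles using (_↔_; Inverse; _⇔_)
open import Level using (0ℓ)


DiGraph : Set → Set₁
DiGraph V = V → V → Set

Graph : Set → Set₁
Graph V = V → V → Set

part : Fin 4 → Fin 3
part zero = zero
part (suc zero) = zero
part (suc (suc zero)) = suc zero
part (suc (suc (suc zero))) = suc (suc zero)

K211 : Graph (Fin 4)
K211 u v = part u ≢ part v

P3∪K1 : Graph (Fin 4)
P3∪K1 zero (suc zero) = ⊤
P3∪K1 (suc zero) zero = ⊤
P3∪K1 (suc zero) (suc (suc zero)) = ⊤
P3∪K1 (suc (suc zero)) (suc zero) = ⊤
P3∪K1 _ _ = ⊥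

_≅_ : {V W : Set} → Graph V → Graph W → Set
_≅_ {V} {W} G H = Σ (V ↔ W) λ f →
  ∀ u v → G u v ⇔ H (Inverse.to f u) (Inverse.to f v)

IsOrientationOf : {V : Set} → DiGraph V → Graph V → Set
IsOrientationOf {V} D G =
  (∀ u v → ¬ (D u v × D v u)) × (∀ u v → G u v ⇔ (D u v ⊎ D v u))

-- D is an orientation of (a graph isomorphic to) K_{2,1,1}: for some relabelling
-- σ of the vertices, D orients the graph {u,v} ~ K211 (σ u) (σ v).
IsOrientationOfK211 : DiGraph (Fin 4) → Set
IsOrientationOfK211 D = Σ (Fin 4 ↔ Fin 4) λ σ →
  IsOrientationOf D (λ u v → K211 (Inverse.to σ u) (Inverse.to σ v))

Niche : {V : Set} → DiGraph V → Graph V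
Niche D u v = (u ≢ v) × ∃ λ w → (D u w × D v w) ⊎ (D w u × D w v)

Connected : {V : Set} → Graph V → Set
Connected {V} G = ∀ (u v : V) → Star G u v

TrueTwins : {V : Set} → DiGraph V → V → V → Set
TrueTwins D u v = (∀ w → D u w ⇔ D v w) × (∀ w → D w u ⇔ D w v)

{-# OPTIONS --safe #-}
-- Relabel so that D orients K₂,₁,₁ with parts {0,1}, {2}, {3} and has the arc 2 → 3.
-- The triangle on x ∈ {0,1} and 2, 3 then has x as a source or sink, is a directed
-- 3-cycle, or is the path 2 → x → 3. If some x is a source or sink, it is a common
-- neighbour of 2 and 3, and each of 0, 1 is niche-adjacent to 2 or 3, except a vertex
-- on a 3-cycle, which is niche-adjacent to x; so the niche graph is connected.
-- Otherwise 0 and 1 have different shapes, since equal shapes make them true twins: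
-- one lies on a 3-cycle and the other on the path. This determines D, and its niche
-- graph is P₃ with the 3-cycle vertex isolated.
module Submission where

open import Defs
open import Data.Fin using (Fin)
open import Data.Fin.Patterns using (0F; 1F; 2F; 3F)
open import Data.Fin.Properties using (_≟_; all?; any?; 0≢1+n)
open import Data.Fin.Permutation using (transpose)
open import Data.Empty using (⊥-elim)
open import Data.Unit using (tt)
open import Data.List using (List; []; _∷_)
open import Data.List.Membership.Propositional using (_∈_)
open import Data.Product.Properties using (≡-dec)
open import Data.List.Membership.DecPropositional (≡-dec (_≟_ {n = 4}) (_≟_ {n = 4}))
  using (_∈?_)
open import Data.List.Relation.Unary.All using (All; []; _∷_; lookup)
open import Data.Product using (_×_; _,_; proj₁; proj₂; swap)
open import Data.Sum using (_⊎_; inj₁; inj₂)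
import Data.Sum as Sum
open import Function using (_∘_; const)
open import Function.Bundles using (_↔_; Inverse; _⇔_; mk⇔; mk↔ₛ′; Equivalence; Injection)
open import Function.Construct.Composition using (_↔-∘_; _⇔-∘_)
open import Function.Construct.Identity using (↔-id; ⇔-id)
open import Function.Construct.Symmetry using (↔-sym; ⇔-sym)
open import Function.Properties.Inverse using (↔⇒↣)
open import Relation.Binary using (Decidable; Symmetric)
open import Relation.Binary.PropositionalEquality using (_≡_; _≢_; refl; sym; cong; subst; subst₂)
open import Relation.Binary.Construct.Closure.ReflexiveTransitive using (Star; ε; _◅_; _◅◅_; gmap; reverse)
open import Relation.Nullary using (¬_; Dec; yes; no; ¬?)
open import Relation.Nullary.Decidable using (from-yes; map′; _×-dec_; _⊎-dec_; _→-dec_)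

open Inverse using (to; from; strictlyInverseˡ; strictlyInverseʳ)
open Equivalence using () renaming (to to ⇒; from to ⇐)

private
  variable
    V W : Set
    D E G H : V → V → Set

TwinFree : DiGraph V → Set
TwinFree D = ∀ u v → TrueTwins D u v → u ≡ v

record TwinFreeDisconnectedOrientation (G : Graph V) (D : DiGraph V) : Set where
  field
    orientation  : IsOrientationOf D G
    disconnected : ¬ Connected (Niche D)
    twinFree     : TwinFree D

subst₂-⇔ : (R : V → V → Set) {a a′ b b′ : V} → a ≡ a′ → b ≡ b′ → R a b ⇔ R a′ b′
subst₂-⇔ R refl refl = ⇔-id _

both-present : {A B : Set} → A → B → A ⇔ B
both-present a b = mk⇔ (const b) (const a)

both-absent : {A B : Set} → ¬ A → ¬ B → A ⇔ B
both-absent ¬a ¬b = mk⇔ (⊥-elim ∘ ¬a) (⊥-elim ∘ ¬b)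

≅-trans : G ≅ E → E ≅ H → G ≅ H
≅-trans (f , p) (g , q) = g ↔-∘ f , λ u v → q (to f u) (to f v) ⇔-∘ p u v

niche-sym : Symmetric (Niche D)
niche-sym (u≢v , w , common) = u≢v ∘ sym , w , Sum.map swap swap common

niche-≅ : D ≅ E → Niche D ≅ Niche E
niche-≅ {D = D} {E = E} (f , p) = f , λ u v → mk⇔ forward backward
  where
  reflect : ∀ {u i} → E (to f u) i → D u (from f i)
  reflect {u} {i} e = ⇐ (p u (from f i)) (⇒ (subst₂-⇔ E refl (sym (strictlyInverseˡ f i))) e)

  reflect′ : ∀ {u i} → E i (to f u) → D (from f i) u
  reflect′ {u} {i} e = ⇐ (p (from f i) u) (⇒ (subst₂-⇔ E (sym (strictlyInverseˡ f i)) refl) e)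

  forward : ∀ {u v} → Niche D u v → Niche E (to f u) (to f v)
  forward {u} {v} (u≢v , w , inj₁ (a , b)) =
    u≢v ∘ Injection.injective (↔⇒↣ f) , to f w , inj₁ (⇒ (p u w) a , ⇒ (p v w) b)
  forward {u} {v} (u≢v , w , inj₂ (a , b)) =
    u≢v ∘ Injection.injective (↔⇒↣ f) , to f w , inj₂ (⇒ (p w u) a , ⇒ (p w v) b)

  backward : ∀ {u v} → Niche E (to f u) (to f v) → Niche D u v
  backward (fu≢fv , i , inj₁ (a , b)) =
    fu≢fv ∘ cong (to f) , from f i , inj₁ (reflect a , reflect b)
  backward (fu≢fv , i , inj₂ (a , b)) =
    fu≢fv ∘ cong (to f) , from f i , inj₂ (reflect′ a , reflect′ b)

connected-≅ : G ≅ H → Connected G → Connected H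
connected-≅ {H = H} (f , p) connected i j =
  subst₂ (Star H) (strictlyInverseˡ f i) (strictlyInverseˡ f j)
    (gmap (to f) (λ {u} {v} → ⇒ (p u v)) (connected (from f i) (from f j)))

reaching⇒connected : {r : V} → Symmetric G → (∀ u → Star G u r) → Connected G
reaching⇒connected sym reach u v = reach u ◅◅ reverse sym (reach v)

module _ (f : V ↔ W) where

  relabel : (V → V → Set) → W → W → Set
  relabel R i j = R (from f i) (from f j)

  ≅-relabel : (R : V → V → Set) → R ≅ relabel R
  ≅-relabel R = f , λ u v →
    subst₂-⇔ R (sym (strictlyInverseʳ f u)) (sym (strictlyInverseʳ f v))

  relabel-≅ : (R : V → V → Set) → relabel R ≅ R
  relabel-≅ R = ↔-sym f , λ i j → ⇔-id _

  niche-≅-via-relabel : {X : Set} {H : Graph X} → Niche (relabel D) ≅ H → Niche D ≅ H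
  niche-≅-via-relabel {D = D} {H = H} = ≅-trans {H = H} (niche-≅ {E = relabel D} (≅-relabel D))

  relabel-reflects-connected : Connected (Niche (relabel D)) → Connected (Niche D)
  relabel-reflects-connected {D = D} = connected-≅ (niche-≅ {E = D} (relabel-≅ D))

  relabel-hypotheses : TwinFreeDisconnectedOrientation (λ u v → G (to f u) (to f v)) D →
                       TwinFreeDisconnectedOrientation G (relabel D)
  relabel-hypotheses {G = G} {D = D} h = record
    { orientation  = (λ i j → proj₁ orientation (from f i) (from f j)) , adjacency
    ; disconnected = disconnected ∘ relabel-reflects-connected
    ; twinFree     = λ i j twins →
                       Injection.injective (↔⇒↣ (↔-sym f)) (twinFree _ _ (unrelabel twins))
    }
    where
    open TwinFreeDisconnectedOrientation h

    adjacency : ∀ i j → G i j ⇔ (relabel D i j ⊎ relabel D j i)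
    adjacency i j = proj₂ orientation (from f i) (from f j)
                      ⇔-∘ subst₂-⇔ G (sym (strictlyInverseˡ f i)) (sym (strictlyInverseˡ f j))

    unrelabel : ∀ {i j} → TrueTwins (relabel D) i j → TrueTwins D (from f i) (from f j)
    unrelabel (out , in′) =
      (λ w → subst (λ x → D (from f _) x ⇔ D (from f _) x) (strictlyInverseʳ f w)
                   (out (to f w))) ,
      (λ w → subst (λ x → D x (from f _) ⇔ D x (from f _)) (strictlyInverseʳ f w)
                   (in′ (to f w)))

IsAutomorphism : Graph V → V ↔ V → Set
IsAutomorphism G π = ∀ u v → G u v ⇔ G (to π u) (to π v)

relabel-automorphism : (f : V ↔ V) → IsAutomorphism G f →
                       TwinFreeDisconnectedOrientation G D →
                       TwinFreeDisconnectedOrientation G (relabel f D)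
relabel-automorphism f automorphism h = relabel-hypotheses f record
  { orientation  = proj₁ orientation , λ u v → proj₂ orientation u v ⇔-∘ ⇔-sym (automorphism u v)
  ; disconnected = disconnected
  ; twinFree     = twinFree
  }
  where open TwinFreeDisconnectedOrientation h

orientation-determined : IsOrientationOf D G → (∀ u v → G u v → E u v ⊎ E v u) →
                         (∀ {u v} → E u v → D u v) → ∀ u v → D u v ⇔ E u v
orientation-determined {D = D} {E = E} (antisymmetric , adjacency) covers E⊆D u v =
  mk⇔ arc∈E E⊆D
  where
  arc∈E : D u v → E u v
  arc∈E d with covers u v (⇐ (adjacency u v) (inj₁ d))
  ... | inj₁ e = e
  ... | inj₂ e = ⊥-elim (antisymmetric u v (d , E⊆D e))

_⇔?_ : {A B : Set} → Dec A → Dec B → Dec (A ⇔ B)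
a? ⇔? b? =
  map′ (λ (f , g) → mk⇔ f g) (λ e → ⇒ e , ⇐ e) ((a? →-dec b?) ×-dec (b? →-dec a?))

niche? : ∀ {n} {D : DiGraph (Fin n)} → Decidable D → Decidable (Niche D)
niche? D? u v =
  ¬? (u ≟ v) ×-dec any? λ w → (D? u w ×-dec D? v w) ⊎-dec (D? w u ×-dec D? w v)

K211? : Decidable K211
K211? u v = ¬? (part u ≟ part v)

P3∪K1? : Decidable P3∪K1
P3∪K1? 0F = λ { 0F → no λ () ; 1F → yes tt ; 2F → no λ () ; 3F → no λ () }
P3∪K1? 1F = λ { 0F → yes tt ; 1F → no λ () ; 2F → yes tt ; 3F → no λ () }
P3∪K1? 2F = λ { 0F → no λ () ; 1F → yes tt ; 2F → no λ () ; 3F → no λ () }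
P3∪K1? 3F = λ { 0F → no λ () ; 1F → no λ () ; 2F → no λ () ; 3F → no λ () }

K211-automorphism? : (π : Fin 4 ↔ Fin 4) → Dec (IsAutomorphism K211 π)
K211-automorphism? π = all? λ u → all? λ v → K211? u v ⇔? K211? (to π u) (to π v)

K211-transpose₀₁ : IsAutomorphism K211 (transpose 0F 1F)
K211-transpose₀₁ = from-yes (K211-automorphism? (transpose 0F 1F))

K211-transpose₂₃ : IsAutomorphism K211 (transpose 2F 3F)
K211-transpose₂₃ = from-yes (K211-automorphism? (transpose 2F 3F))

cyclicMiddleArcs : List (Fin 4 × Fin 4)
cyclicMiddleArcs = (2F , 3F) ∷ (0F , 2F) ∷ (3F , 0F) ∷ (2F , 1F) ∷ (1F , 3F) ∷ []

CyclicMiddle : DiGraph (Fin 4)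
CyclicMiddle u v = (u , v) ∈ cyclicMiddleArcs

cyclicMiddle-covers-K211 : ∀ u v → K211 u v → CyclicMiddle u v ⊎ CyclicMiddle v u
cyclicMiddle-covers-K211 = from-yes (all? λ u → all? λ v →
  K211? u v →-dec ((u , v) ∈? cyclicMiddleArcs ⊎-dec (v , u) ∈? cyclicMiddleArcs))

niche-cyclicMiddle : Niche CyclicMiddle ≅ P3∪K1
niche-cyclicMiddle = ρ , from-yes (all? λ u → all? λ v →
  niche? (λ u v → (u , v) ∈? cyclicMiddleArcs) u v ⇔? P3∪K1? (to ρ u) (to ρ v))
  where
  -- the niche path 2 - 1 - 3 goes to 0 - 1 - 2 and the isolated vertex 0 to 3
  ρ : Fin 4 ↔ Fin 4
  ρ = mk↔ₛ′ (λ { 0F → 3F ; 1F → 1F ; 2F → 0F ; 3F → 2F })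
            (λ { 0F → 2F ; 1F → 1F ; 2F → 3F ; 3F → 0F })
            (λ { 0F → refl ; 1F → refl ; 2F → refl ; 3F → refl })
            (λ { 0F → refl ; 1F → refl ; 2F → refl ; 3F → refl })

Extreme : DiGraph V → V → V → V → Set
Extreme D c d x = (D x c × D x d) ⊎ (D c x × D d x)

data Triangle (D : DiGraph V) (c d x : V) : Set where
  extreme : Extreme D c d x → Triangle D c d x
  cyclic  : D x c → D d x → Triangle D c d x
  middle  : D c x → D x d → Triangle D c d x

triangle : {c d x : V} → D x c ⊎ D c x → D x d ⊎ D d x → Triangle D c d x
triangle (inj₁ xc) (inj₁ xd) = extreme (inj₁ (xc , xd))
triangle (inj₂ cx) (inj₂ dx) = extreme (inj₂ (cx , dx))
triangle (inj₁ xc) (inj₂ dx) = cyclic xc dx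
triangle (inj₂ cx) (inj₁ xd) = middle cx xd

SameArcs : DiGraph V → V → V → V → Set
SameArcs D x y w = (D x w × D y w) ⊎ (D w x × D w y)

module OrientationOfK211 {D : DiGraph (Fin 4)} (orientation : IsOrientationOf D K211) where

  arc : ∀ u v → K211 u v → D u v ⊎ D v u
  arc u v = ⇒ (proj₂ orientation u v)

  no-arc-within-part : ∀ {u v} → part u ≡ part v → ¬ D u v
  no-arc-within-part same d = ⇐ (proj₂ orientation _ _) (inj₁ d) same

  antisymmetric : ∀ {u v} → D u v → ¬ D v u
  antisymmetric d d′ = proj₁ orientation _ _ (d , d′)

  triangle₀ : Triangle D 2F 3F 0F
  triangle₀ = triangle (arc 0F 2F λ ()) (arc 0F 3F λ ())

  triangle₁ : Triangle D 2F 3F 1F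
  triangle₁ = triangle (arc 1F 2F λ ()) (arc 1F 3F λ ())

  same-arcs⇒twins : SameArcs D 0F 1F 2F → SameArcs D 0F 1F 3F → TrueTwins D 0F 1F
  same-arcs⇒twins same₂ same₃ = out , in′
    where
    same : ∀ {w} → SameArcs D 0F 1F w → (D 0F w ⇔ D 1F w) × (D w 0F ⇔ D w 1F)
    same (inj₁ (a , b)) = both-present a b , both-absent (antisymmetric a) (antisymmetric b)
    same (inj₂ (a , b)) = both-absent (antisymmetric a) (antisymmetric b) , both-present a b

    out : ∀ w → D 0F w ⇔ D 1F w
    out 0F = both-absent (no-arc-within-part refl) (no-arc-within-part refl)
    out 1F = both-absent (no-arc-within-part refl) (no-arc-within-part refl)
    out 2F = proj₁ (same same₂)
    out 3F = proj₁ (same same₃)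

    in′ : ∀ w → D w 0F ⇔ D w 1F
    in′ 0F = both-absent (no-arc-within-part refl) (no-arc-within-part refl)
    in′ 1F = both-absent (no-arc-within-part refl) (no-arc-within-part refl)
    in′ 2F = proj₂ (same same₂)
    in′ 3F = proj₂ (same same₃)

  extreme⇒connected : D 2F 3F → Extreme D 2F 3F 0F → Connected (Niche D)
  extreme⇒connected c→d extreme₀ = reaching⇒connected (niche-sym {D = D}) reach
    where
    cd : Niche D 2F 3F
    cd = (λ ()) , 0F , Sum.swap extreme₀

    attach : ∀ {x} → x ≢ 2F → x ≢ 3F → D x 3F ⊎ D 2F x → Star (Niche D) x 2F
    attach x≢c _ (inj₁ x→d) = (x≢c , 3F , inj₁ (x→d , c→d)) ◅ ε
    attach _ x≢d (inj₂ c→x) = (x≢d , 2F , inj₂ (c→x , c→d)) ◅ niche-sym {D = D} cd ◅ ε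

    reach₀ : Star (Niche D) 0F 2F
    reach₀ = attach (λ ()) (λ ()) (Sum.map proj₂ proj₁ extreme₀)

    reach₁ : Star (Niche D) 1F 2F
    reach₁ with triangle₁
    ... | extreme extreme₁ = attach (λ ()) (λ ()) (Sum.map proj₂ proj₁ extreme₁)
    ... | middle _ 1→d = attach (λ ()) (λ ()) (inj₁ 1→d)
    ... | cyclic 1→c d→1 = linked 1→c d→1 extreme₀ ◅ reach₀
      where
      linked : D 1F 2F → D 3F 1F → Extreme D 2F 3F 0F → Niche D 1F 0F
      linked 1→c _ (inj₁ (0→c , _)) = (λ ()) , 2F , inj₁ (1→c , 0→c)
      linked _ d→1 (inj₂ (_ , d→0)) = (λ ()) , 3F , inj₂ (d→1 , d→0)

    reach : ∀ u → Star (Niche D) u 2F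
    reach 0F = reach₀
    reach 1F = reach₁
    reach 2F = ε
    reach 3F = niche-sym {D = D} cd ◅ ε

  cyclic-middle⇒niche≅P3∪K1 :
    D 2F 3F → D 0F 2F → D 3F 0F → D 2F 1F → D 1F 3F → Niche D ≅ P3∪K1
  cyclic-middle⇒niche≅P3∪K1 c→d 0→c d→0 c→1 1→d =
    ≅-trans {H = P3∪K1} (niche-≅ {E = CyclicMiddle} (↔-id _ , D⇔CyclicMiddle)) niche-cyclicMiddle
    where
    arcs : All (λ (u , v) → D u v) cyclicMiddleArcs
    arcs = c→d ∷ 0→c ∷ d→0 ∷ c→1 ∷ 1→d ∷ []

    D⇔CyclicMiddle : ∀ u v → D u v ⇔ CyclicMiddle u v
    D⇔CyclicMiddle = orientation-determined orientation cyclicMiddle-covers-K211 (lookup arcs)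

module _ {D : DiGraph (Fin 4)} (h : TwinFreeDisconnectedOrientation K211 D) where
  open TwinFreeDisconnectedOrientation h
  open OrientationOfK211 orientation

  private
    swapped : TwinFreeDisconnectedOrientation K211 (relabel (transpose 0F 1F) D)
    swapped = relabel-automorphism (transpose 0F 1F) K211-transpose₀₁ h

    module Swapped = OrientationOfK211 (TwinFreeDisconnectedOrientation.orientation swapped)

  niche≅P3∪K1-if-2→3 : D 2F 3F → Niche D ≅ P3∪K1
  niche≅P3∪K1-if-2→3 c→d with triangle₀ | triangle₁
  ... | extreme extreme₀ | _ = ⊥-elim (disconnected (extreme⇒connected c→d extreme₀))
  ... | _ | extreme extreme₁ =
    ⊥-elim (disconnected (relabel-reflects-connected (transpose 0F 1F)
                            (Swapped.extreme⇒connected c→d extreme₁)))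
  ... | cyclic 0→c d→0 | cyclic 1→c d→1 =
    ⊥-elim (0≢1+n (twinFree 0F 1F (same-arcs⇒twins (inj₁ (0→c , 1→c)) (inj₂ (d→0 , d→1)))))
  ... | middle c→0 0→d | middle c→1 1→d =
    ⊥-elim (0≢1+n (twinFree 0F 1F (same-arcs⇒twins (inj₂ (c→0 , c→1)) (inj₁ (0→d , 1→d)))))
  ... | cyclic 0→c d→0 | middle c→1 1→d = cyclic-middle⇒niche≅P3∪K1 c→d 0→c d→0 c→1 1→d
  ... | middle c→0 0→d | cyclic 1→c d→1 =
    niche-≅-via-relabel (transpose 0F 1F) {H = P3∪K1}
      (Swapped.cyclic-middle⇒niche≅P3∪K1 c→d 1→c d→1 c→0 0→d)

niche≅P3∪K1 : TwinFreeDisconnectedOrientation K211 D → Niche D ≅ P3∪K1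
niche≅P3∪K1 h with OrientationOfK211.arc (TwinFreeDisconnectedOrientation.orientation h) 2F 3F (λ ())
... | inj₁ 2→3 = niche≅P3∪K1-if-2→3 h 2→3
... | inj₂ 3→2 = niche-≅-via-relabel (transpose 2F 3F) {H = P3∪K1}
                   (niche≅P3∪K1-if-2→3
                     (relabel-automorphism (transpose 2F 3F) K211-transpose₂₃ h) 3→2)

lemma3p6 : (D : DiGraph (Fin 4)) → IsOrientationOfK211 D → ¬ Connected (Niche D)
    → (∀ u v → TrueTwins D u v → u ≡ v) → Niche D ≅ P3∪K1
lemma3p6 D (σ , orientation) disconnected twinFree =
  niche-≅-via-relabel σ {H = P3∪K1} (niche≅P3∪K1 (relabel-hypotheses σ record
    { orientation = orientation ; disconnected = disconnected ; twinFree = twinFree }))
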